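{- Let $n$ be a positive integer and let $m \in \{0,1,\dots,2n\}$. Then \begin{equation*} \sum_{j=0}^{n}\binom{n}{j}\binom{j}{m-j}2^{2j-m}= \sum_{\substack{0\le r\le 2n\\ r+m+n \text{ even}}} \binom{n}{\frac{r-m+n}{2}}\binom{n}{\frac{r+m-n}{2}}, \end{equation*} \begin{equation*} (n+1)\sum_{j=0}^{n}\binom{n}{j}\binom{j}{m-j}2^{2j-m}= \sum_{\substack{0\le r\le 2n\\ r+m+n \text{ even}}} \binom{n}{\frac{r-m+n}{2}}\binom{n}{\frac{r+m-n}{2}}(r+1), \end{equation*} \begin{equation*} (2^{n+1}-1)\sum_{j=0}^{n}\binom{n}{j}\binom{j}{m-j}2^{n-j}3^{2j-m}= \sum_{\substack{0\le r\le 2n\\ r+m+n \text{ even}}} \binom{n}{\frac{r-m+n}{2}}\binom{n}{\frac{r+m-n}{2}}2^{(3n-r-m)/2}(2^{r+1}-1), \end{equation*} and \begin{equation*} F_{n+2}\sum_{j=0}^{n}\binom{n}{j}\binom{j}{m-j}(-1)^{m+j}= \sum_{\substack{0\le r\le 2n\\ r+m+n \text{ even}}} \binom{n}{\frac{r-m+n}{2}}\binom{n}{\frac{r+m-n}{2}}(-1)^{(-n+r-m)/2}F_{r+2}. \end{equation*}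
   Context: $\{F_n\}$ denotes the Fibonacci sequence, defined by $F_0=0$, $F_1=1$ and $F_{i+1}=F_i+F_{i-1}$ for $i\ge 1$. Binomial coefficients $\binom{j}{k}$ are taken to be $0$ when $k<0$ or $k>j$. -}

module Defs where

open import Data.Nat as ℕ using (ℕ; zero; suc; _≟_)
open import Data.Nat.DivMod using (_%_)
open import Data.Nat.Combinatorics using (_C_)
open import Data.Integer as ℤ using (ℤ; +_; -[1+_]; ∣_∣; _/ℕ_)
open import Relation.Nullary using (yes; no)

fib : ℕ → ℕ
fib zero = zero
fib (suc zero) = suc zero
fib (suc (suc i)) = fib (suc i) ℕ.+ fib i

-- binomial coefficient with integer lower index; 0 when k < 0 (and, via _C_, when k > j)
binom : ℕ → ℤ → ℤ
binom j (+ k) = + (j C k)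
binom j -[1+ k ] = + 0

-- b ^ e for an integer exponent e ≥ 0.  For e < 0 the value 0 is a junk value;
-- in the statement it only ever occurs multiplied by a vanishing binomial.
powℤ : ℤ → ℤ → ℤ
powℤ b (+ k) = b ℤ.^ k
powℤ b -[1+ k ] = + 0

-- (-1)^e for an arbitrary integer exponent e (exact, since (-1)^(-e) = (-1)^e)
signPow : ℤ → ℤ
signPow e = (ℤ.- (+ 1)) ℤ.^ ∣ e ∣

-- integer halving; exact whenever its argument is even (the only case used)
half : ℤ → ℤ
half z = z /ℕ 2

sumTo : ℕ → (ℕ → ℤ) → ℤ
sumTo zero f = f zero
sumTo (suc n) f = sumTo n f ℤ.+ f (suc n)

sumToEven : ℕ → ℕ → (ℕ → ℤ) → ℤ
sumToEven n c f = sumTo n (λ i → g i ((i ℕ.+ c) % 2 ≟ 0))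
  where
  open import Relation.Nullary using (Dec)
  open import Relation.Binary.PropositionalEquality using (_≡_)
  g : (i : ℕ) → Dec ((i ℕ.+ c) % 2 ≡ 0) → ℤ
  g i (yes _) = f i
  g i (no _)  = + 0

-- Write a = n - i and j = i + m - n, so that a + j = m.  Every right-hand side has the form
--   Σ_r A(r) f(r) = Σ_i C(n,i) C(n,j) f(i + j)                   (evenSum-as-pairSum),
-- a "coupled sum" pairSum n m W.  Every left-hand side has the form Σ_j C(n,j) C(j,m-j) w_j,
-- which is the coefficient coeffQuad Z X Y n m of x^m in (Z + X x + Y x²)^n
-- (binomSum-as-coeffQuad).  The identities then follow from three evaluations of coupled sums,
-- each proved by induction on n through Pascal's rule on both binomials (pairSum-pascal):
--   * coeffQuad-factor: (γδ + (αδ+γβ) x + αβ x²)^n = (γ + αx)^n (δ + βx)^n coefficientwise,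
--     giving identities 1 and 3 (for (1+x)^(2n) and (2+x)^n (1+x)^n);
--   * pairSum-excess: the weights i + j - n sum to zero, giving identity 2 from identity 1;
--   * pairSum-fib: the weights (-1)^(n-i) F(k+i+j) sum to F(k+n) [x^m](1 + x - x²)^n,
--     giving identity 4.
-- The file develops finite sums, coupled sums and their Pascal rule, coeffQuad and its
-- recurrence, the three evaluations, the two translations, and finally the four identities.
module Submission where

open import Defs
open import Data.Nat as ℕ using (ℕ; _≤_; NonZero; zero; suc; z≤n; s≤s)
open import Data.Integer as ℤ using (ℤ; +_; -_; _+_; _-_; _*_; _^_; -[1+_])
import Data.Nat.Properties as NP
import Data.Integer.Properties as ZP
open import Data.Nat.Combinatorics using (_C_; nCk+nC[k+1]≡[n+1]C[k+1]; k>n⇒nCk≡0)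
open import Data.Integer.Tactic.RingSolver using (solve-∀)
open import Data.Nat.DivMod using (_%_)
import Data.Nat.DivMod as ND
open import Data.Product using (_×_; _,_)
open import Relation.Binary.PropositionalEquality
open import Relation.Nullary using (Dec; yes; no)
open import Data.Empty using (⊥-elim)

open ≡-Reasoning

sumTo-cong : ∀ N {f g : ℕ → ℤ} → (∀ i → i ≤ N → f i ≡ g i) → sumTo N f ≡ sumTo N g
sumTo-cong zero    eq = eq 0 z≤n
sumTo-cong (suc N) eq =
  cong₂ _+_ (sumTo-cong N (λ i i≤N → eq i (NP.m≤n⇒m≤1+n i≤N))) (eq (suc N) NP.≤-refl)

sumTo-+ : ∀ N (f g : ℕ → ℤ) → sumTo N (λ i → f i + g i) ≡ sumTo N f + sumTo N g
sumTo-+ zero    f g = refl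
sumTo-+ (suc N) f g = begin
  sumTo N (λ i → f i + g i) + (f (suc N) + g (suc N))
    ≡⟨ cong (_+ (f (suc N) + g (suc N))) (sumTo-+ N f g) ⟩
  (sumTo N f + sumTo N g) + (f (suc N) + g (suc N))
    ≡⟨ interchange (sumTo N f) (sumTo N g) (f (suc N)) (g (suc N)) ⟩
  (sumTo N f + f (suc N)) + (sumTo N g + g (suc N)) ∎
  where
  interchange : ∀ a b c d → (a + b) + (c + d) ≡ (a + c) + (b + d)
  interchange = solve-∀

sumTo-scale : ∀ N c (f : ℕ → ℤ) → sumTo N (λ i → c * f i) ≡ c * sumTo N f
sumTo-scale zero    c f = refl
sumTo-scale (suc N) c f =
  trans (cong (_+ c * f (suc N)) (sumTo-scale N c f)) (sym (ZP.*-distribˡ-+ c (sumTo N f) (f (suc N))))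

sumTo-peel : ∀ N (f : ℕ → ℤ) → sumTo (suc N) f ≡ f 0 + sumTo N (λ i → f (suc i))
sumTo-peel zero    f = refl
sumTo-peel (suc N) f = trans (cong (_+ f (suc (suc N))) (sumTo-peel N f)) (ZP.+-assoc (f 0) _ _)

sumTo-dropFirst : ∀ N (f : ℕ → ℤ) → f 0 ≡ + 0 → sumTo (suc N) f ≡ sumTo N (λ i → f (suc i))
sumTo-dropFirst N f f0≡0 =
  trans (sumTo-peel N f) (trans (cong (_+ sumTo N (λ i → f (suc i))) f0≡0) (ZP.+-identityˡ _))

sumTo-dropLast : ∀ N (f : ℕ → ℤ) → f (suc N) ≡ + 0 → sumTo (suc N) f ≡ sumTo N f
sumTo-dropLast N f fN≡0 = trans (cong (λ u → sumTo N f + u) fN≡0) (ZP.+-identityʳ _)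

sumTo-vanish : ∀ N {f : ℕ → ℤ} → (∀ i → i ≤ N → f i ≡ + 0) → sumTo N f ≡ + 0
sumTo-vanish zero    eq = eq 0 z≤n
sumTo-vanish (suc N) eq =
  cong₂ _+_ (sumTo-vanish N (λ i i≤N → eq i (NP.m≤n⇒m≤1+n i≤N))) (eq (suc N) NP.≤-refl)

sumTo-single : ∀ N i₀ {f : ℕ → ℤ} → i₀ ≤ N → (∀ i → i ≤ N → i ≢ i₀ → f i ≡ + 0) → sumTo N f ≡ f i₀
sumTo-single zero .zero z≤n _ = refl
sumTo-single (suc N) i₀ {f} i₀≤ others with i₀ ℕ.≟ suc N
... | yes refl = trans (cong (_+ f (suc N)) rest) (ZP.+-identityˡ _)
  where
  rest = sumTo-vanish N (λ i i≤N → others i (NP.m≤n⇒m≤1+n i≤N) (NP.<⇒≢ (s≤s i≤N)))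
... | no i₀≢ = trans (cong₂ _+_ rest (others (suc N) NP.≤-refl (λ e → i₀≢ (sym e)))) (ZP.+-identityʳ _)
  where
  rest = sumTo-single N i₀ (NP.≤-pred (NP.≤∧≢⇒< i₀≤ i₀≢)) (λ i i≤N → others i (NP.m≤n⇒m≤1+n i≤N))

sumTo-interchange : ∀ N K (h : ℕ → ℕ → ℤ) →
  sumTo N (λ i → sumTo K (λ r → h i r)) ≡ sumTo K (λ r → sumTo N (λ i → h i r))
sumTo-interchange zero    K h = refl
sumTo-interchange (suc N) K h =
  trans (cong (_+ sumTo K (h (suc N))) (sumTo-interchange N K h)) (sym (sumTo-+ K _ _))

onlyIf : {P : Set} → Dec P → ℤ → ℤ
onlyIf (yes _) v = v
onlyIf (no _)  _ = + 0

evenTerm : ℕ → (ℕ → ℤ) → ℕ → ℤ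
evenTerm c f i = onlyIf ((i ℕ.+ c) % 2 ℕ.≟ 0) (f i)

-- The summand of sumToEven does not depend on the range, so sumToEven grows one evenTerm at a time.
sumToEven-suc : ∀ N c f → sumToEven (suc N) c f ≡ sumToEven N c f + evenTerm c f (suc N)
sumToEven-suc N c f with (suc N ℕ.+ c) % 2 ℕ.≟ 0
... | yes _ = refl
... | no _  = refl

sumToEven-as-sumTo : ∀ N c f → sumToEven N c f ≡ sumTo N (evenTerm c f)
sumToEven-as-sumTo zero c f with (0 ℕ.+ c) % 2 ℕ.≟ 0
... | yes _ = refl
... | no _  = refl
sumToEven-as-sumTo (suc N) c f =
  trans (sumToEven-suc N c f) (cong (_+ evenTerm c f (suc N)) (sumToEven-as-sumTo N c f))

sumToEven-cong : ∀ N c {f g : ℕ → ℤ} → (∀ r → f r ≡ g r) → sumToEven N c f ≡ sumToEven N c g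
sumToEven-cong N c {f} {g} f≗g = begin
  sumToEven N c f       ≡⟨ sumToEven-as-sumTo N c f ⟩
  sumTo N (evenTerm c f) ≡⟨ sumTo-cong N (λ r _ → cong (onlyIf _) (f≗g r)) ⟩
  sumTo N (evenTerm c g) ≡⟨ sumToEven-as-sumTo N c g ⟨
  sumToEven N c g       ∎

+-sub : ∀ a b → b ≤ a → + a - + b ≡ + (a ℕ.∸ b)
+-sub a b b≤a = trans (ZP.[+m]-[+n]≡m⊖n a b) (ZP.⊖-≥ b≤a)

half-double : ∀ w → half (w * + 2) ≡ w
half-double (+ k)    = trans (cong half (sym (ZP.pos-* k 2))) (cong +_ (ND.m*n/n≡m k 2))
half-double -[1+ k ] rewrite ND.m*n%n≡0 (suc k) 2 ⦃ _ ⦄ = cong (λ u → - (+ u)) (ND.m*n/n≡m (suc k) 2)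

zero-*-* : ∀ x y → + 0 * x * y ≡ + 0
zero-*-* x y = trans (cong (_* y) (ZP.*-zeroˡ x)) (ZP.*-zeroˡ y)

*-zero-* : ∀ x y → x * + 0 * y ≡ + 0
*-zero-* x y = trans (cong (_* y) (ZP.*-zeroʳ x)) (ZP.*-zeroˡ y)

binom-vanish : ∀ n k → n ℕ.< k → binom n (+ k) ≡ + 0
binom-vanish n k n<k = cong +_ (k>n⇒nCk≡0 n<k)

binom-pascal : ∀ n k → binom (suc n) k ≡ binom n k + binom n (k - + 1)
binom-pascal n -[1+ k ]  = refl
binom-pascal n (+ zero)  = refl
binom-pascal n (+ suc k) = cong +_ (trans (sym (nCk+nC[k+1]≡[n+1]C[k+1] n k)) (NP.+-comm (n C k) _))

-- The coupled sum  pairSum n m W = Σ_i C(n,i) C(n,j) W(i,j),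
-- j = partner n m i, runs over the pairs with (n - i) + j = m: it is the coefficient of
-- x^m in a product of two binomial expansions of degree n (see coeffQuad-factor below).
partner : ℕ → ℤ → ℕ → ℤ
partner n m i = + i + (m - + n)

pairSum : ℕ → ℤ → (ℕ → ℤ → ℤ) → ℤ
pairSum n m W = sumTo n (λ i → binom n (+ i) * binom n (partner n m i) * W i (partner n m i))

pairSum-cong : ∀ n m {V W : ℕ → ℤ → ℤ} →
  (∀ i k → i ≤ n → k ≤ n → partner n m i ≡ + k → V i (+ k) ≡ W i (+ k)) →
  pairSum n m V ≡ pairSum n m W
pairSum-cong n m {V} {W} V≗W = sumTo-cong n (λ i i≤n → summand i i≤n (partner n m i) refl)
  where
  summand : ∀ i → i ≤ n → (j : ℤ) → partner n m i ≡ j →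
            binom n (+ i) * binom n j * V i j ≡ binom n (+ i) * binom n j * W i j
  summand i i≤n -[1+ k ] _ = trans (*-zero-* (binom n (+ i)) (V i -[1+ k ])) (sym (*-zero-* (binom n (+ i)) (W i -[1+ k ])))
  summand i i≤n (+ k) p≡k with k ℕ.≤? n
  ... | yes k≤n = cong (binom n (+ i) * binom n (+ k) *_) (V≗W i k i≤n k≤n p≡k)
  ... | no k≰n  = trans (vanishes V) (sym (vanishes W))
    where
    vanishes : ∀ U → binom n (+ i) * binom n (+ k) * U i (+ k) ≡ + 0
    vanishes U = trans (cong (λ u → binom n (+ i) * u * U i (+ k)) (binom-vanish n k (NP.≰⇒> k≰n)))
                       (*-zero-* (binom n (+ i)) (U i (+ k)))

pairSum-+ : ∀ n m (V W : ℕ → ℤ → ℤ) → pairSum n m (λ i j → V i j + W i j) ≡ pairSum n m V + pairSum n m W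
pairSum-+ n m V W = trans (sumTo-cong n (λ i _ → termwise i)) (sumTo-+ n _ _)
  where
  distrib : ∀ a b v w → a * b * (v + w) ≡ a * b * v + a * b * w
  distrib = solve-∀
  termwise : ∀ i → let j = partner n m i in
    binom n (+ i) * binom n j * (V i j + W i j) ≡ binom n (+ i) * binom n j * V i j + binom n (+ i) * binom n j * W i j
  termwise i = distrib (binom n (+ i)) (binom n (partner n m i)) (V i (partner n m i)) (W i (partner n m i))

pairSum-scale : ∀ n m c (W : ℕ → ℤ → ℤ) → pairSum n m (λ i j → c * W i j) ≡ c * pairSum n m W
pairSum-scale n m c W = trans (sumTo-cong n (λ i _ → termwise i)) (sumTo-scale n c _)
  where
  pull-out : ∀ a b c w → a * b * (c * w) ≡ c * (a * b * w)
  pull-out = solve-∀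
  termwise : ∀ i → let j = partner n m i in
    binom n (+ i) * binom n j * (c * W i j) ≡ c * (binom n (+ i) * binom n j * W i j)
  termwise i = pull-out (binom n (+ i)) (binom n (partner n m i)) c (W i (partner n m i))

-- Pascal's rule applied to both binomial factors: the recursion driving every induction below.
pairSum-pascal : ∀ n m (W : ℕ → ℤ → ℤ) → pairSum (suc n) m W ≡
    pairSum n (m - + 1) W + pairSum n (m - + 2) (λ i j → W i (+ 1 + j))
  + pairSum n m (λ i j → W (suc i) j) + pairSum n (m - + 1) (λ i j → W (suc i) (+ 1 + j))
pairSum-pascal n m W = begin
  pairSum (suc n) m W
    ≡⟨ sumTo-cong (suc n) (λ i _ → expand i) ⟩
  sumTo (suc n) (λ i → t₁ i + t₂ i + t₃ i + t₄ i)
    ≡⟨ trans (sumTo-+ (suc n) _ t₄) (cong (_+ sumTo (suc n) t₄)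
        (trans (sumTo-+ (suc n) _ t₃) (cong (_+ sumTo (suc n) t₃) (sumTo-+ (suc n) t₁ t₂)))) ⟩
  sumTo (suc n) t₁ + sumTo (suc n) t₂ + sumTo (suc n) t₃ + sumTo (suc n) t₄
    ≡⟨ cong₂ _+_ (cong₂ _+_ (cong₂ _+_ sum₁ sum₂) sum₃) sum₄ ⟩
  pairSum n (m - + 1) W + pairSum n (m - + 2) (λ i j → W i (+ 1 + j))
  + pairSum n m (λ i j → W (suc i) j) + pairSum n (m - + 1) (λ i j → W (suc i) (+ 1 + j)) ∎
  where
  b = binom n
  p : ℕ → ℤ
  p = partner (suc n) m
  t₁ t₂ t₃ t₄ : ℕ → ℤ
  t₁ i = b (+ i) * b (p i) * W i (p i)
  t₂ i = b (+ i) * b (p i - + 1) * W i (p i)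
  t₃ i = b (+ i - + 1) * b (p i) * W i (p i)
  t₄ i = b (+ i - + 1) * b (p i - + 1) * W i (p i)
  expand-product : ∀ a a' c c' w → (a + a') * (c + c') * w ≡ a * c * w + a * c' * w + a' * c * w + a' * c' * w
  expand-product = solve-∀
  expand : ∀ i → binom (suc n) (+ i) * binom (suc n) (p i) * W i (p i) ≡ t₁ i + t₂ i + t₃ i + t₄ i
  expand i = trans (cong₂ (λ u v → u * v * W i (p i)) (binom-pascal n (+ i)) (binom-pascal n (p i)))
                   (expand-product (b (+ i)) (b (+ i - + 1)) (b (p i)) (b (p i - + 1)) (W i (p i)))
  -- the partner of i for (n+1, m), rewritten relative to (n, m'), m' ∈ {m, m-1, m-2}
  shift₁ : ∀ x m y → x + (m - (+ 1 + y)) ≡ x + (m - + 1 - y)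
  shift₁ = solve-∀
  shift₂ : ∀ x m y → x + (m - (+ 1 + y)) - + 1 ≡ x + (m - + 2 - y)
  shift₂ = solve-∀
  shift₂' : ∀ x m y → x + (m - (+ 1 + y)) ≡ + 1 + (x + (m - + 2 - y))
  shift₂' = solve-∀
  shift₃ : ∀ x m y → (+ 1 + x) + (m - (+ 1 + y)) ≡ x + (m - y)
  shift₃ = solve-∀
  shift₄ : ∀ x m y → (+ 1 + x) + (m - (+ 1 + y)) - + 1 ≡ x + (m - + 1 - y)
  shift₄ = solve-∀
  shift₄' : ∀ x m y → (+ 1 + x) + (m - (+ 1 + y)) ≡ + 1 + (x + (m - + 1 - y))
  shift₄' = solve-∀
  last-vanishes : ∀ u w → b (+ suc n) * u * w ≡ + 0
  last-vanishes u w = trans (cong (λ v → v * u * w) (binom-vanish n (suc n) NP.≤-refl)) (zero-*-* u w)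
  sum₁ : sumTo (suc n) t₁ ≡ pairSum n (m - + 1) W
  sum₁ = trans (sumTo-dropLast n t₁ (last-vanishes _ _))
               (sumTo-cong n (λ i _ → cong (λ u → b (+ i) * b u * W i u) (shift₁ (+ i) m (+ n))))
  sum₂ : sumTo (suc n) t₂ ≡ pairSum n (m - + 2) (λ i j → W i (+ 1 + j))
  sum₂ = trans (sumTo-dropLast n t₂ (last-vanishes _ _))
               (sumTo-cong n (λ i _ → cong₂ (λ u v → b (+ i) * b u * W i v)
                                             (shift₂ (+ i) m (+ n)) (shift₂' (+ i) m (+ n))))
  sum₃ : sumTo (suc n) t₃ ≡ pairSum n m (λ i j → W (suc i) j)
  sum₃ = trans (sumTo-dropFirst n t₃ (zero-*-* (b (p 0)) (W 0 (p 0))))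
               (sumTo-cong n (λ i _ → cong (λ u → b (+ i) * b u * W (suc i) u) (shift₃ (+ i) m (+ n))))
  sum₄ : sumTo (suc n) t₄ ≡ pairSum n (m - + 1) (λ i j → W (suc i) (+ 1 + j))
  sum₄ = trans (sumTo-dropFirst n t₄ (zero-*-* (b (p 0 - + 1)) (W 0 (p 0))))
               (sumTo-cong n (λ i _ → cong₂ (λ u v → b (+ i) * b u * W (suc i) v)
                                             (shift₄ (+ i) m (+ n)) (shift₄' (+ i) m (+ n))))

-- trinom X Y j k = C(j,k) X^(j-k) Y^k is the coefficient of x^k in (X + Y x)^j (zero for k < 0).
trinom : ℤ → ℤ → ℕ → ℤ → ℤ
trinom X Y j (+ k)    = + (j C k) * X ^ (j ℕ.∸ k) * Y ^ k
trinom X Y j -[1+ k ] = + 0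

-- coeffQuad Z X Y n m is the coefficient of x^m in (Z + X x + Y x²)^n = (Z + x (X + Y x))^n,
-- expanded binomially in the two summands Z and x (X + Y x).
coeffQuad : ℤ → ℤ → ℤ → ℕ → ℤ → ℤ
coeffQuad Z X Y n m = sumTo n (λ j → binom n (+ j) * Z ^ (n ℕ.∸ j) * trinom X Y j (m - + j))

∸-pred : ∀ n j → j ℕ.< n → n ℕ.∸ j ≡ suc (n ℕ.∸ suc j)
∸-pred (suc n) zero    _         = refl
∸-pred (suc n) (suc j) (s≤s j<n) = ∸-pred n j j<n

-- (X + Y x)^(j+1) = X (X + Y x)^j + Y x (X + Y x)^j, coefficientwise.
trinom-pascal : ∀ X Y j k → trinom X Y (suc j) k ≡ X * trinom X Y j k + Y * trinom X Y j (k - + 1)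
trinom-pascal X Y j -[1+ k ] = sym (cong₂ _+_ (ZP.*-zeroʳ X) (ZP.*-zeroʳ Y))
trinom-pascal X Y j (+ zero) = constant-term X Y (X ^ j)
  where
  constant-term : ∀ X Y P → + 1 * (X * P) * + 1 ≡ X * (+ 1 * P * + 1) + Y * + 0
  constant-term = solve-∀
trinom-pascal X Y j (+ suc k) with suc k ℕ.≤? j
... | yes k<j = begin
  + (suc j C suc k) * X ^ (j ℕ.∸ k) * (Y * Y ^ k)
    ≡⟨ cong₂ (λ c e → + c * X ^ e * (Y * Y ^ k)) (sym (nCk+nC[k+1]≡[n+1]C[k+1] j k)) (∸-pred j k k<j) ⟩
  (+ (j C k) + + (j C suc k)) * (X * X ^ (j ℕ.∸ suc k)) * (Y * Y ^ k)
    ≡⟨ regroup X Y (+ (j C k)) (+ (j C suc k)) (X ^ (j ℕ.∸ suc k)) (Y ^ k) ⟩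
  X * (+ (j C suc k) * X ^ (j ℕ.∸ suc k) * (Y * Y ^ k)) + Y * (+ (j C k) * (X * X ^ (j ℕ.∸ suc k)) * Y ^ k)
    ≡⟨ cong (λ e → X * (+ (j C suc k) * X ^ (j ℕ.∸ suc k) * (Y * Y ^ k)) + Y * (+ (j C k) * e * Y ^ k))
            (cong (X ^_) (sym (∸-pred j k k<j))) ⟩
  X * (+ (j C suc k) * X ^ (j ℕ.∸ suc k) * (Y * Y ^ k)) + Y * (+ (j C k) * X ^ (j ℕ.∸ k) * Y ^ k) ∎
  where
  regroup : ∀ X Y c c' P Q → (c + c') * (X * P) * (Y * Q) ≡ X * (c' * P * (Y * Q)) + Y * (c * (X * P) * Q)
  regroup = solve-∀
... | no k≮j = begin
  + (suc j C suc k) * X ^ (j ℕ.∸ k) * (Y * Y ^ k)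
    ≡⟨ cong (λ c → + c * X ^ (j ℕ.∸ k) * (Y * Y ^ k)) (sym (nCk+nC[k+1]≡[n+1]C[k+1] j k)) ⟩
  + (j C k ℕ.+ j C suc k) * X ^ (j ℕ.∸ k) * (Y * Y ^ k)
    ≡⟨ cong (λ c → + (j C k ℕ.+ c) * X ^ (j ℕ.∸ k) * (Y * Y ^ k)) top-vanishes ⟩
  (+ (j C k) + + 0) * X ^ (j ℕ.∸ k) * (Y * Y ^ k)
    ≡⟨ regroup X Y (+ (j C k)) (X ^ (j ℕ.∸ k)) (X ^ (j ℕ.∸ suc k)) (Y ^ k) ⟩
  X * (+ 0 * X ^ (j ℕ.∸ suc k) * (Y * Y ^ k)) + Y * (+ (j C k) * X ^ (j ℕ.∸ k) * Y ^ k)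
    ≡⟨ cong (λ c → X * (+ c * X ^ (j ℕ.∸ suc k) * (Y * Y ^ k)) + Y * (+ (j C k) * X ^ (j ℕ.∸ k) * Y ^ k))
            (sym top-vanishes) ⟩
  X * (+ (j C suc k) * X ^ (j ℕ.∸ suc k) * (Y * Y ^ k)) + Y * (+ (j C k) * X ^ (j ℕ.∸ k) * Y ^ k) ∎
  where
  top-vanishes : j C suc k ≡ 0
  top-vanishes = k>n⇒nCk≡0 (NP.≰⇒> k≮j)
  regroup : ∀ X Y c E P Q → (c + + 0) * E * (Y * Q) ≡ X * (+ 0 * P * (Y * Q)) + Y * (c * E * Q)
  regroup = solve-∀

-- (Z + X x + Y x²)^(n+1) = (Z + X x + Y x²) (Z + X x + Y x²)^n, coefficientwise.
coeffQuad-rec : ∀ Z X Y n m → coeffQuad Z X Y (suc n) m ≡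
  Z * coeffQuad Z X Y n m + (X * coeffQuad Z X Y n (m - + 1) + Y * coeffQuad Z X Y n (m - + 2))
coeffQuad-rec Z X Y n m = begin
  coeffQuad Z X Y (suc n) m
    ≡⟨ sumTo-cong (suc n) (λ j _ → pascal j) ⟩
  sumTo (suc n) (λ j → a j + b j)
    ≡⟨ sumTo-+ (suc n) a b ⟩
  sumTo (suc n) a + sumTo (suc n) b
    ≡⟨ cong₂ _+_ kept shifted ⟩
  Z * L m + (X * L (m - + 1) + Y * L (m - + 2)) ∎
  where
  T = trinom X Y
  L = coeffQuad Z X Y n
  -- the binomial C(n+1,j) = C(n,j) + C(n,j-1) splits the summands into a j + b j
  a b : ℕ → ℤ
  a j = binom n (+ j) * Z ^ (suc n ℕ.∸ j) * T j (m - + j)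
  b j = binom n (+ j - + 1) * Z ^ (suc n ℕ.∸ j) * T j (m - + j)
  distrib : ∀ c c' P Q → (c + c') * P * Q ≡ c * P * Q + c' * P * Q
  distrib = solve-∀
  pascal : ∀ j → binom (suc n) (+ j) * Z ^ (suc n ℕ.∸ j) * T j (m - + j) ≡ a j + b j
  pascal j = trans (cong (λ c → c * Z ^ (suc n ℕ.∸ j) * T j (m - + j)) (binom-pascal n (+ j)))
                   (distrib (binom n (+ j)) (binom n (+ j - + 1)) (Z ^ (suc n ℕ.∸ j)) (T j (m - + j)))
  pull-Z : ∀ Z c P Q → c * (Z * P) * Q ≡ Z * (c * P * Q)
  pull-Z = solve-∀
  kept : sumTo (suc n) a ≡ Z * L m
  kept = begin
    sumTo (suc n) a
      ≡⟨ sumTo-dropLast n a (trans (cong (λ c → c * Z ^ (n ℕ.∸ n) * T (suc n) (m - + suc n)) (binom-vanish n (suc n) NP.≤-refl))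
                                   (zero-*-* (Z ^ (n ℕ.∸ n)) (T (suc n) (m - + suc n)))) ⟩
    sumTo n a
      ≡⟨ sumTo-cong n (λ j j≤n → trans (cong (λ e → binom n (+ j) * Z ^ e * T j (m - + j)) (NP.+-∸-assoc 1 j≤n))
                                       (pull-Z Z (binom n (+ j)) (Z ^ (n ℕ.∸ j)) (T j (m - + j)))) ⟩
    sumTo n (λ j → Z * (binom n (+ j) * Z ^ (n ℕ.∸ j) * T j (m - + j)))
      ≡⟨ sumTo-scale n Z _ ⟩
    Z * L m ∎
  shift₁ : ∀ m y → m - (+ 1 + y) ≡ m - + 1 - y
  shift₁ = solve-∀
  shift₂ : ∀ m y → m - (+ 1 + y) - + 1 ≡ m - + 2 - y
  shift₂ = solve-∀
  split : ∀ X Y c P u v → c * P * (X * u + Y * v) ≡ X * (c * P * u) + Y * (c * P * v)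
  split = solve-∀
  step : ∀ j → b (suc j) ≡ X * (binom n (+ j) * Z ^ (n ℕ.∸ j) * T j (m - + 1 - + j))
                          + Y * (binom n (+ j) * Z ^ (n ℕ.∸ j) * T j (m - + 2 - + j))
  step j = trans (cong (binom n (+ j) * Z ^ (n ℕ.∸ j) *_)
                   (trans (trinom-pascal X Y j (m - + suc j))
                          (cong₂ (λ u v → X * T j u + Y * T j v) (shift₁ m (+ j)) (shift₂ m (+ j)))))
                 (split X Y (binom n (+ j)) (Z ^ (n ℕ.∸ j)) _ _)
  shifted : sumTo (suc n) b ≡ X * L (m - + 1) + Y * L (m - + 2)
  shifted = begin
    sumTo (suc n) b
      ≡⟨ sumTo-dropFirst n b (zero-*-* (Z ^ suc n) (T 0 (m - + 0))) ⟩
    sumTo n (λ j → b (suc j))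
      ≡⟨ sumTo-cong n (λ j _ → step j) ⟩
    sumTo n (λ j → X * _ + Y * _)
      ≡⟨ trans (sumTo-+ n _ _) (cong₂ _+_ (sumTo-scale n X _) (sumTo-scale n Y _)) ⟩
    X * L (m - + 1) + Y * L (m - + 2) ∎

-- The weight of the pair (n - i, j) in (γ + α x)^n (δ + β x)^n, without the binomials:
-- α^(n-i) γ^i from the first factor and β^j δ^(n-j) from the second (zero for j < 0).
rightWeight : ℤ → ℤ → ℕ → ℤ → ℤ
rightWeight β δ n (+ k)    = β ^ k * δ ^ (n ℕ.∸ k)
rightWeight β δ n -[1+ _ ] = + 0

productWeight : ℤ → ℤ → ℤ → ℤ → ℕ → ℕ → ℤ → ℤ
productWeight γ α β δ n i j = γ ^ i * α ^ (n ℕ.∸ i) * rightWeight β δ n j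

-- (γδ + (αδ + γβ) x + αβ x²)^n = (γ + α x)^n (δ + β x)^n, compared coefficientwise.
coeffQuad-factor : ∀ γ α β δ n m →
  coeffQuad (γ * δ) (α * δ + γ * β) (α * β) n m ≡ pairSum n m (productWeight γ α β δ n)
coeffQuad-factor γ α β δ zero m = base (m - + 0)
  where
  base : ∀ k → + 1 * + 1 * trinom (α * δ + γ * β) (α * β) 0 k
             ≡ + 1 * binom 0 (+ 0 + k) * (+ 1 * + 1 * rightWeight β δ 0 (+ 0 + k))
  base -[1+ k ]  = refl
  base (+ zero)  = refl
  base (+ suc k) = refl
coeffQuad-factor γ α β δ (suc n) m = begin
  coeffQuad Z X Y (suc n) m
    ≡⟨ coeffQuad-rec Z X Y n m ⟩
  Z * L m + (X * L (m - + 1) + Y * L (m - + 2))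
    ≡⟨ cong₂ (λ u v → Z * u + v) (coeffQuad-factor γ α β δ n m)
             (cong₂ (λ u v → X * u + Y * v) (coeffQuad-factor γ α β δ n (m - + 1))
                                            (coeffQuad-factor γ α β δ n (m - + 2))) ⟩
  Z * R m + (X * R (m - + 1) + Y * R (m - + 2))
    ≡⟨ regroup γ α β δ (R m) (R (m - + 1)) (R (m - + 2)) ⟩
  α * δ * R (m - + 1) + α * β * R (m - + 2) + γ * δ * R m + γ * β * R (m - + 1)
    ≡⟨ sym (cong₂ _+_ (cong₂ _+_ (cong₂ _+_ piece₁ piece₂) piece₃) piece₄) ⟩
  pairSum n (m - + 1) W' + pairSum n (m - + 2) (λ i j → W' i (+ 1 + j))
  + pairSum n m (λ i j → W' (suc i) j) + pairSum n (m - + 1) (λ i j → W' (suc i) (+ 1 + j))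
    ≡⟨ pairSum-pascal n m W' ⟨
  pairSum (suc n) m W' ∎
  where
  Z = γ * δ
  X = α * δ + γ * β
  Y = α * β
  L = coeffQuad Z X Y n
  W = productWeight γ α β δ n
  W' = productWeight γ α β δ (suc n)
  R = λ m' → pairSum n m' W
  regroup : ∀ γ α β δ R₀ R₁ R₂ → γ * δ * R₀ + ((α * δ + γ * β) * R₁ + α * β * R₂)
                                ≡ α * δ * R₁ + α * β * R₂ + γ * δ * R₀ + γ * β * R₁
  regroup = solve-∀
  scaled : ∀ m' c (V : ℕ → ℤ → ℤ) → (∀ i k → i ≤ n → k ≤ n → V i (+ k) ≡ c * W i (+ k)) →
           pairSum n m' V ≡ c * R m'
  scaled m' c V V≡cW = trans (pairSum-cong n m' {V} {λ i j → c * W i j} (λ i k i≤n k≤n _ → V≡cW i k i≤n k≤n)) (pairSum-scale n m' c W)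
  factor₁ : ∀ γ α β δ G A B D → G * (α * A) * (B * (δ * D)) ≡ α * δ * (G * A * (B * D))
  factor₁ = solve-∀
  factor₂ : ∀ γ α β δ G A B D → G * (α * A) * ((β * B) * D) ≡ α * β * (G * A * (B * D))
  factor₂ = solve-∀
  factor₃ : ∀ γ α β δ G A B D → (γ * G) * A * (B * (δ * D)) ≡ γ * δ * (G * A * (B * D))
  factor₃ = solve-∀
  factor₄ : ∀ γ α β δ G A B D → (γ * G) * A * ((β * B) * D) ≡ γ * β * (G * A * (B * D))
  factor₄ = solve-∀
  piece₁ : pairSum n (m - + 1) W' ≡ α * δ * R (m - + 1)
  piece₁ = scaled (m - + 1) (α * δ) W' (λ i k i≤n k≤n →
    trans (cong₂ (λ u v → γ ^ i * α ^ u * (β ^ k * δ ^ v)) (NP.+-∸-assoc 1 i≤n) (NP.+-∸-assoc 1 k≤n))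
          (factor₁ γ α β δ (γ ^ i) (α ^ (n ℕ.∸ i)) (β ^ k) (δ ^ (n ℕ.∸ k))))
  piece₂ : pairSum n (m - + 2) (λ i j → W' i (+ 1 + j)) ≡ α * β * R (m - + 2)
  piece₂ = scaled (m - + 2) (α * β) (λ i j → W' i (+ 1 + j)) (λ i k i≤n k≤n →
    trans (cong (λ u → γ ^ i * α ^ u * (β ^ suc k * δ ^ (n ℕ.∸ k))) (NP.+-∸-assoc 1 i≤n))
          (factor₂ γ α β δ (γ ^ i) (α ^ (n ℕ.∸ i)) (β ^ k) (δ ^ (n ℕ.∸ k))))
  piece₃ : pairSum n m (λ i j → W' (suc i) j) ≡ γ * δ * R m
  piece₃ = scaled m (γ * δ) (λ i j → W' (suc i) j) (λ i k i≤n k≤n →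
    trans (cong (λ v → γ ^ suc i * α ^ (n ℕ.∸ i) * (β ^ k * δ ^ v)) (NP.+-∸-assoc 1 k≤n))
          (factor₃ γ α β δ (γ ^ i) (α ^ (n ℕ.∸ i)) (β ^ k) (δ ^ (n ℕ.∸ k))))
  piece₄ : pairSum n (m - + 1) (λ i j → W' (suc i) (+ 1 + j)) ≡ γ * β * R (m - + 1)
  piece₄ = scaled (m - + 1) (γ * β) (λ i j → W' (suc i) (+ 1 + j)) (λ i k _ _ →
    factor₄ γ α β δ (γ ^ i) (α ^ (n ℕ.∸ i)) (β ^ k) (δ ^ (n ℕ.∸ k)))

-- excess n i j = i + j - n = b - a for the pair (a, b) = (n - i, j).  Its coupled sum vanishes,
-- since the pairs (a, b) and (b, a) contribute opposite excesses; here proved by induction.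
excess : ℕ → ℕ → ℤ → ℤ
excess n i j = + i + j - + n

pairSum-excess : ∀ n m → pairSum n m (excess n) ≡ + 0
pairSum-excess zero m = base (m - + 0)
  where
  base : ∀ k → + 1 * binom 0 (+ 0 + k) * excess 0 0 (+ 0 + k) ≡ + 0
  base -[1+ k ]  = refl
  base (+ zero)  = refl
  base (+ suc k) = refl
pairSum-excess (suc n) m = begin
  pairSum (suc n) m E'
    ≡⟨ pairSum-pascal n m E' ⟩
  P₁ + P₂ + P₃ + P₄
    ≡⟨ regroup P₁ P₂ P₃ P₄ ⟩
  (P₁ + P₄) + P₂ + P₃
    ≡⟨ cong₂ _+_ (cong₂ _+_ outer inner₂) inner₃ ⟩
  + 2 * + 0 + + 0 + + 0
    ≡⟨⟩
  + 0 ∎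
  where
  E = excess n
  E' = excess (suc n)
  P₁ = pairSum n (m - + 1) E'
  P₂ = pairSum n (m - + 2) (λ i j → E' i (+ 1 + j))
  P₃ = pairSum n m (λ i j → E' (suc i) j)
  P₄ = pairSum n (m - + 1) (λ i j → E' (suc i) (+ 1 + j))
  regroup : ∀ a b c d → a + b + c + d ≡ (a + d) + b + c
  regroup = solve-∀
  shift-j : ∀ x j y → x + (+ 1 + j) - (+ 1 + y) ≡ x + j - y
  shift-j = solve-∀
  shift-i : ∀ x j y → (+ 1 + x) + j - (+ 1 + y) ≡ x + j - y
  shift-i = solve-∀
  doubled : ∀ x j y → (x + j - (+ 1 + y)) + ((+ 1 + x) + (+ 1 + j) - (+ 1 + y)) ≡ + 2 * (x + j - y)
  doubled = solve-∀
  inner₂ : P₂ ≡ + 0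
  inner₂ = trans (pairSum-cong n (m - + 2) {λ i j → E' i (+ 1 + j)} {E} (λ i k _ _ _ → shift-j (+ i) (+ k) (+ n))) (pairSum-excess n (m - + 2))
  inner₃ : P₃ ≡ + 0
  inner₃ = trans (pairSum-cong n m {λ i j → E' (suc i) j} {E} (λ i k _ _ _ → shift-i (+ i) (+ k) (+ n))) (pairSum-excess n m)
  outer : P₁ + P₄ ≡ + 2 * + 0
  outer = begin
    P₁ + P₄
      ≡⟨ pairSum-+ n (m - + 1) E' (λ i j → E' (suc i) (+ 1 + j)) ⟨
    pairSum n (m - + 1) (λ i j → E' i j + E' (suc i) (+ 1 + j))
      ≡⟨ pairSum-cong n (m - + 1) {λ i j → E' i j + E' (suc i) (+ 1 + j)} {λ i j → + 2 * E i j} (λ i k _ _ _ → doubled (+ i) (+ k) (+ n)) ⟩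
    pairSum n (m - + 1) (λ i j → + 2 * E i j)
      ≡⟨ pairSum-scale n (m - + 1) (+ 2) E ⟩
    + 2 * pairSum n (m - + 1) E
      ≡⟨ cong (+ 2 *_) (pairSum-excess n (m - + 1)) ⟩
    + 2 * + 0 ∎

fibℤ : ℤ → ℤ
fibℤ (+ t)     = + fib t
fibℤ -[1+ _ ]  = + 0

fibWeight : ℕ → ℕ → ℕ → ℤ → ℤ
fibWeight n k i j = (- (+ 1)) ^ (n ℕ.∸ i) * fibℤ (+ k + (+ i + j))

-- The Pascal step turns F(k+i+j) into the shifts F(k+1+i+j), F(k+2+i+j), and the
-- Fibonacci recurrence recombines them into the recurrence of coeffQuad 1 1 (-1).
pairSum-fib : ∀ n m k → pairSum n m (fibWeight n k) ≡ + fib (k ℕ.+ n) * coeffQuad (+ 1) (+ 1) (- (+ 1)) n m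
pairSum-fib zero m k = base (m - + 0)
  where
  base : ∀ j → + 1 * binom 0 (+ 0 + j) * fibWeight 0 k 0 (+ 0 + j)
             ≡ + fib (k ℕ.+ 0) * (+ 1 * + 1 * trinom (+ 1) (- (+ 1)) 0 j)
  units : ∀ F → + 1 * + 1 * (+ 1 * F) ≡ F * (+ 1 * + 1 * (+ 1 * + 1 * + 1))
  units = solve-∀
  base -[1+ j ]  = sym (ZP.*-zeroʳ (+ fib (k ℕ.+ 0)))
  base (+ zero)  = units (+ fib (k ℕ.+ 0))
  base (+ suc j) = sym (ZP.*-zeroʳ (+ fib (k ℕ.+ 0)))
pairSum-fib (suc n) m k = begin
  pairSum (suc n) m W'
    ≡⟨ pairSum-pascal n m W' ⟩
  pairSum n (m - + 1) W' + pairSum n (m - + 2) (λ i j → W' i (+ 1 + j))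
  + pairSum n m (λ i j → W' (suc i) j) + pairSum n (m - + 1) (λ i j → W' (suc i) (+ 1 + j))
    ≡⟨ cong₂ _+_ (cong₂ _+_ (cong₂ _+_ piece₁ piece₂) piece₃) piece₄ ⟩
  - + 1 * (F₀ * L (m - + 1)) + - + 1 * (F₁ * L (m - + 2)) + F₁ * L m + (F₁ + F₀) * L (m - + 1)
    ≡⟨ recombine F₀ F₁ (L m) (L (m - + 1)) (L (m - + 2)) ⟩
  F₁ * (+ 1 * L m + (+ 1 * L (m - + 1) + - + 1 * L (m - + 2)))
    ≡⟨ cong₂ _*_ (cong (λ u → + fib u) (sym (NP.+-suc k n))) (sym (coeffQuad-rec (+ 1) (+ 1) (- (+ 1)) n m)) ⟩
  + fib (k ℕ.+ suc n) * coeffQuad (+ 1) (+ 1) (- (+ 1)) (suc n) m ∎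
  where
  L = coeffQuad (+ 1) (+ 1) (- (+ 1)) n
  W' = fibWeight (suc n) k
  F₀ F₁ : ℤ
  F₀ = + fib (k ℕ.+ n)
  F₁ = + fib (suc (k ℕ.+ n))
  recombine : ∀ a b L₀ L₁ L₂ → - + 1 * (a * L₁) + - + 1 * (b * L₂) + b * L₀ + (b + a) * L₁
                              ≡ b * (+ 1 * L₀ + (+ 1 * L₁ + - + 1 * L₂))
  recombine = solve-∀
  sign-out : ∀ s F → (- + 1 * s) * F ≡ - + 1 * (s * F)
  sign-out = solve-∀
  shift-j : ∀ k x j → k + (x + (+ 1 + j)) ≡ (+ 1 + k) + (x + j)
  shift-j = solve-∀
  shift-i : ∀ k x j → k + ((+ 1 + x) + j) ≡ (+ 1 + k) + (x + j)
  shift-i = solve-∀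
  shift-ij : ∀ k x j → k + ((+ 1 + x) + (+ 1 + j)) ≡ (+ 1 + (+ 1 + k)) + (x + j)
  shift-ij = solve-∀
  sign-step : ∀ i k' j → i ≤ n → (- + 1) ^ (suc n ℕ.∸ i) * fibℤ (+ k' + (+ i + j))
                                  ≡ - + 1 * fibWeight n k' i j
  sign-step i k' j i≤n = trans (cong (λ u → (- + 1) ^ u * fibℤ (+ k' + (+ i + j))) (NP.+-∸-assoc 1 i≤n))
                               (sign-out ((- + 1) ^ (n ℕ.∸ i)) (fibℤ (+ k' + (+ i + j))))
  piece₁ : pairSum n (m - + 1) W' ≡ - + 1 * (F₀ * L (m - + 1))
  piece₁ = begin
    pairSum n (m - + 1) W'
      ≡⟨ pairSum-cong n (m - + 1) {W'} {λ i j → - + 1 * fibWeight n k i j} (λ i k' i≤n _ _ → sign-step i k (+ k') i≤n) ⟩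
    pairSum n (m - + 1) (λ i j → - + 1 * fibWeight n k i j)
      ≡⟨ pairSum-scale n (m - + 1) (- + 1) (fibWeight n k) ⟩
    - + 1 * pairSum n (m - + 1) (fibWeight n k)
      ≡⟨ cong (- + 1 *_) (pairSum-fib n (m - + 1) k) ⟩
    - + 1 * (F₀ * L (m - + 1)) ∎
  piece₂ : pairSum n (m - + 2) (λ i j → W' i (+ 1 + j)) ≡ - + 1 * (F₁ * L (m - + 2))
  piece₂ = begin
    pairSum n (m - + 2) (λ i j → W' i (+ 1 + j))
      ≡⟨ pairSum-cong n (m - + 2) {λ i j → W' i (+ 1 + j)} {λ i j → - + 1 * fibWeight n (suc k) i j} (λ i k' i≤n _ _ →
           trans (cong (λ u → (- + 1) ^ (suc n ℕ.∸ i) * fibℤ u) (shift-j (+ k) (+ i) (+ k')))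
                 (sign-step i (suc k) (+ k') i≤n)) ⟩
    pairSum n (m - + 2) (λ i j → - + 1 * fibWeight n (suc k) i j)
      ≡⟨ pairSum-scale n (m - + 2) (- + 1) (fibWeight n (suc k)) ⟩
    - + 1 * pairSum n (m - + 2) (fibWeight n (suc k))
      ≡⟨ cong (- + 1 *_) (pairSum-fib n (m - + 2) (suc k)) ⟩
    - + 1 * (F₁ * L (m - + 2)) ∎
  piece₃ : pairSum n m (λ i j → W' (suc i) j) ≡ F₁ * L m
  piece₃ = trans (pairSum-cong n m {λ i j → W' (suc i) j} {fibWeight n (suc k)} (λ i k' _ _ _ →
                   cong (λ u → (- + 1) ^ (n ℕ.∸ i) * fibℤ u) (shift-i (+ k) (+ i) (+ k'))))
                 (pairSum-fib n m (suc k))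
  piece₄ : pairSum n (m - + 1) (λ i j → W' (suc i) (+ 1 + j)) ≡ (F₁ + F₀) * L (m - + 1)
  piece₄ = trans (pairSum-cong n (m - + 1) {λ i j → W' (suc i) (+ 1 + j)} {fibWeight n (suc (suc k))} (λ i k' _ _ _ →
                   cong (λ u → (- + 1) ^ (n ℕ.∸ i) * fibℤ u) (shift-ij (+ k) (+ i) (+ k'))))
                 (pairSum-fib n (m - + 1) (suc (suc k)))

ext : (ℕ → ℤ) → ℤ → ℤ
ext f (+ r)    = f r
ext f -[1+ _ ] = + 0

Aterm : ℕ → ℕ → ℕ → ℤ
Aterm n m r = binom n (half (+ r - + m + + n)) * binom n (half (+ r + + m - + n))

-- The summand of pairSum n m (λ i j → ext f (i + j)) at i, placed at r = i + j:
-- pairs (i, r) with r = i + partner n m i index both sides of evenSum-as-pairSum.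
pairTerm : ℕ → ℕ → (ℕ → ℤ) → ℕ → ℤ
pairTerm n m f i = binom n (+ i) * binom n (partner n (+ m) i) * ext f (+ i + partner n (+ m) i)

placed : ℕ → ℕ → (ℕ → ℤ) → ℕ → ℕ → ℤ
placed n m f i r = onlyIf (+ r ZP.≟ + i + partner n (+ m) i) (pairTerm n m f i)

placed-hit : ∀ n m f i r → + r ≡ + i + partner n (+ m) i → placed n m f i r ≡ pairTerm n m f i
placed-hit n m f i r hit with + r ZP.≟ + i + partner n (+ m) i
... | yes _    = refl
... | no miss = ⊥-elim (miss hit)

placed-miss : ∀ n m f i r → + r ≢ + i + partner n (+ m) i → placed n m f i r ≡ + 0
placed-miss n m f i r miss with + r ZP.≟ + i + partner n (+ m) i
... | yes hit = ⊥-elim (miss hit)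
... | no _    = refl

placed-zero : ∀ n m f i r → pairTerm n m f i ≡ + 0 → placed n m f i r ≡ + 0
placed-zero n m f i r t≡0 with + r ZP.≟ + i + partner n (+ m) i
... | yes _ = t≡0
... | no _  = refl

placed-parity : ∀ r i m n → r ≡ i + (i + (m - n)) → r + (m + n) ≡ (i + m) * + 2
placed-parity r i m n r≡ = trans (cong (_+ (m + n)) r≡) (parity i m n)
  where
  parity : ∀ i m n → i + (i + (m - n)) + (m + n) ≡ (i + m) * + 2
  parity = solve-∀

-- For r + m + n = 2q, the r-th summand is indexed by i = q - m, j = q - n.
module EvenSplit (r m n q : ℤ) (r+m+n≡2q : r + (m + n) ≡ q * + 2) where

  half-left : r - m + n ≡ (q - m) * + 2
  half-left = trans (rearrange r m n) (trans (cong (λ u → u - m - m) r+m+n≡2q) (double q m))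
    where
    rearrange : ∀ r m n → r - m + n ≡ r + (m + n) - m - m
    rearrange = solve-∀
    double : ∀ q m → q * + 2 - m - m ≡ (q - m) * + 2
    double = solve-∀

  half-right : r + m - n ≡ (q - n) * + 2
  half-right = trans (rearrange r m n) (trans (cong (λ u → u - n - n) r+m+n≡2q) (double q n))
    where
    rearrange : ∀ r m n → r + m - n ≡ r + (m + n) - n - n
    rearrange = solve-∀
    double : ∀ q n → q * + 2 - n - n ≡ (q - n) * + 2
    double = solve-∀

  index-from-placed : ∀ i → r ≡ i + (i + (m - n)) → i ≡ q - m
  index-from-placed i r≡ = sym (ZP.*-cancelʳ-≡ (q - m) i (+ 2)
    (trans (sym half-left) (trans (cong (λ u → u - m + n) r≡) (double i m n))))
    where
    double : ∀ i m n → i + (i + (m - n)) - m + n ≡ i * + 2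
    double = solve-∀

  placed-from-index : ∀ i → i ≡ q - m → r ≡ i + (i + (m - n))
  placed-from-index i i≡ = trans (rearrange r m n) (trans (cong (λ u → u - m - n) r+m+n≡2q)
                                                          (trans (split q m n) (cong (λ u → u + (u + (m - n))) (sym i≡))))
    where
    rearrange : ∀ r m n → r ≡ r + (m + n) - m - n
    rearrange = solve-∀
    split : ∀ q m n → q * + 2 - m - n ≡ (q - m) + ((q - m) + (m - n))
    split = solve-∀

  partner-from-index : ∀ i → i ≡ q - m → i + (m - n) ≡ q - n
  partner-from-index i i≡ = trans (cong (_+ (m - n)) i≡) (cancel q m n)
    where
    cancel : ∀ q m n → (q - m) + (m - n) ≡ q - n
    cancel = solve-∀

-- Column sums: for fixed i, exactly one r ≤ 2n carries pairTerm i (if it is non-zero).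
placed-column : ∀ n m f i → i ≤ n → sumTo (2 ℕ.* n) (placed n m f i) ≡ pairTerm n m f i
placed-column n m f i i≤n = by-partner (partner n (+ m) i) refl
  where
  all-zero : pairTerm n m f i ≡ + 0 → sumTo (2 ℕ.* n) (placed n m f i) ≡ pairTerm n m f i
  all-zero t≡0 = trans (sumTo-vanish (2 ℕ.* n) (λ r _ → placed-zero n m f i r t≡0)) (sym t≡0)
  by-partner : (j : ℤ) → partner n (+ m) i ≡ j → sumTo (2 ℕ.* n) (placed n m f i) ≡ pairTerm n m f i
  by-partner -[1+ k ] p≡j = all-zero (trans (cong (λ u → binom n (+ i) * binom n u * ext f (+ i + u)) p≡j)
                                             (*-zero-* (binom n (+ i)) (ext f (+ i + -[1+ k ]))))
  by-partner (+ k) p≡k with k ℕ.≤? n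
  ... | no k≰n = all-zero (trans (cong (λ u → binom n (+ i) * binom n u * ext f (+ i + u)) p≡k)
                                 (trans (cong (λ u → binom n (+ i) * u * ext f (+ i + + k)) (binom-vanish n k (NP.≰⇒> k≰n)))
                                        (*-zero-* (binom n (+ i)) (ext f (+ i + + k)))))
  ... | yes k≤n = trans (sumTo-single (2 ℕ.* n) (i ℕ.+ k) i+k≤2n others)
                        (placed-hit n m f i (i ℕ.+ k) (cong (λ u → + i + u) (sym p≡k)))
    where
    i+k≤2n : i ℕ.+ k ≤ 2 ℕ.* n
    i+k≤2n = subst (i ℕ.+ k ≤_) (cong (n ℕ.+_) (sym (NP.+-identityʳ n))) (NP.+-mono-≤ i≤n k≤n)
    others : ∀ r → r ≤ 2 ℕ.* n → r ≢ i ℕ.+ k → placed n m f i r ≡ + 0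
    others r _ r≢ = placed-miss n m f i r (λ r≡ → r≢ (ZP.+-injective (trans r≡ (cong (λ u → + i + u) p≡k))))

-- Row sums: the r-th summand of the corollary is the sum of the pairTerms placed at r.
placed-row : ∀ n m f r → evenTerm (m ℕ.+ n) (λ r → Aterm n m r * f r) r ≡ sumTo n (λ i → placed n m f i r)
placed-row n m f r with (r ℕ.+ (m ℕ.+ n)) % 2 ℕ.≟ 0
... | no odd = sym (sumTo-vanish n (λ i _ → placed-miss n m f i r (λ r≡ → odd (even-if-placed i r≡))))
  where
  even-if-placed : ∀ i → + r ≡ + i + partner n (+ m) i → (r ℕ.+ (m ℕ.+ n)) % 2 ≡ 0
  even-if-placed i r≡ = subst (λ x → x % 2 ≡ 0) (sym (ZP.+-injective (trans (placed-parity (+ r) (+ i) (+ m) (+ n) r≡) (sym (ZP.pos-* (i ℕ.+ m) 2)))))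
                              (ND.m*n%n≡0 (i ℕ.+ m) 2)
... | yes even = trans (cong₂ (λ u v → binom n u * binom n v * f r) half-left' half-right') (by-index (+ q - + m) refl)
  where
  q = (r ℕ.+ (m ℕ.+ n)) ND./ 2
  r+m+n≡2q : + r + (+ m + + n) ≡ + q * + 2
  r+m+n≡2q = trans (cong +_ (trans (ND.m≡m%n+[m/n]*n (r ℕ.+ (m ℕ.+ n)) 2) (cong (ℕ._+ q ℕ.* 2) even)))
                   (ZP.pos-* q 2)
  open EvenSplit (+ r) (+ m) (+ n) (+ q) r+m+n≡2q
  half-left' : half (+ r - + m + + n) ≡ + q - + m
  half-left' = trans (cong half half-left) (half-double (+ q - + m))
  half-right' : half (+ r + + m - + n) ≡ + q - + n
  half-right' = trans (cong half half-right) (half-double (+ q - + n))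
  term = binom n (+ q - + m) * binom n (+ q - + n) * f r
  no-index : ∀ a → + q - + m ≡ a → binom n a ≡ + 0 → (∀ i → i ≤ n → a ≢ + i) → term ≡ sumTo n (λ i → placed n m f i r)
  no-index a q-m≡a binom≡0 none = trans
    (trans (cong (λ u → binom n u * binom n (+ q - + n) * f r) q-m≡a)
           (trans (cong (λ u → u * binom n (+ q - + n) * f r) binom≡0) (zero-*-* (binom n (+ q - + n)) (f r))))
    (sym (sumTo-vanish n (λ i i≤n → placed-miss n m f i r (λ r≡ → none i i≤n (trans (sym q-m≡a) (sym (index-from-placed (+ i) r≡)))))))
  by-index : ∀ a → + q - + m ≡ a → term ≡ sumTo n (λ i → placed n m f i r)
  by-index -[1+ k ] q-m≡a = no-index -[1+ k ] q-m≡a refl (λ i _ ())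
  by-index (+ i₀) q-m≡i₀ with i₀ ℕ.≤? n
  ... | no i₀≰n = no-index (+ i₀) q-m≡i₀ (binom-vanish n i₀ (NP.≰⇒> i₀≰n))
                           (λ i i≤n i₀≡i → i₀≰n (subst (_≤ n) (sym (ZP.+-injective i₀≡i)) i≤n))
  ... | yes i₀≤n = sym (trans (sumTo-single n i₀ i₀≤n others) (trans (placed-hit n m f i₀ r at-i₀) matches))
    where
    i₀≡q-m : + i₀ ≡ + q - + m
    i₀≡q-m = sym q-m≡i₀
    others : ∀ i → i ≤ n → i ≢ i₀ → placed n m f i r ≡ + 0
    others i _ i≢i₀ = placed-miss n m f i r (λ r≡ → i≢i₀ (ZP.+-injective (trans (index-from-placed (+ i) r≡) q-m≡i₀)))
    at-i₀ : + r ≡ + i₀ + partner n (+ m) i₀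
    at-i₀ = placed-from-index (+ i₀) i₀≡q-m
    matches : pairTerm n m f i₀ ≡ term
    matches = begin
      binom n (+ i₀) * binom n (partner n (+ m) i₀) * ext f (+ i₀ + partner n (+ m) i₀)
        ≡⟨ cong (λ u → binom n (+ i₀) * binom n (partner n (+ m) i₀) * ext f u) (sym at-i₀) ⟩
      binom n (+ i₀) * binom n (partner n (+ m) i₀) * f r
        ≡⟨ cong₂ (λ u v → binom n u * binom n v * f r) i₀≡q-m (partner-from-index (+ i₀) i₀≡q-m) ⟩
      term ∎

-- The sum over r in the corollary is a coupled sum: the r-th summand A r f(r)
-- collects the pairs (i, j) with i + j = r.
evenSum-as-pairSum : ∀ n m f →
  sumToEven (2 ℕ.* n) (m ℕ.+ n) (λ r → Aterm n m r * f r) ≡ pairSum n (+ m) (λ i j → ext f (+ i + j))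
evenSum-as-pairSum n m f = begin
  sumToEven (2 ℕ.* n) (m ℕ.+ n) (λ r → Aterm n m r * f r)
    ≡⟨ sumToEven-as-sumTo (2 ℕ.* n) (m ℕ.+ n) _ ⟩
  sumTo (2 ℕ.* n) (evenTerm (m ℕ.+ n) (λ r → Aterm n m r * f r))
    ≡⟨ sumTo-cong (2 ℕ.* n) (λ r _ → placed-row n m f r) ⟩
  sumTo (2 ℕ.* n) (λ r → sumTo n (λ i → placed n m f i r))
    ≡⟨ sumTo-interchange n (2 ℕ.* n) (placed n m f) ⟨
  sumTo n (λ i → sumTo (2 ℕ.* n) (placed n m f i))
    ≡⟨ sumTo-cong n (placed-column n m f) ⟩
  pairSum n (+ m) (λ i j → ext f (+ i + j)) ∎

binomSum-as-coeffQuad : ∀ Z X Y n M (W : ℕ → ℤ) →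
  (∀ j t → j ≤ n → t ≤ j → M - + j ≡ + t → W j ≡ Z ^ (n ℕ.∸ j) * (X ^ (j ℕ.∸ t) * Y ^ t)) →
  sumTo n (λ j → binom n (+ j) * binom j (M - + j) * W j) ≡ coeffQuad Z X Y n M
binomSum-as-coeffQuad Z X Y n M W W≡ = sumTo-cong n (λ j j≤n → summand j j≤n (M - + j) refl)
  where
  regroup : ∀ a b P Q R → a * b * (P * (Q * R)) ≡ a * P * (b * Q * R)
  regroup = solve-∀
  summand : ∀ j → j ≤ n → (k : ℤ) → M - + j ≡ k →
            binom n (+ j) * binom j k * W j ≡ binom n (+ j) * Z ^ (n ℕ.∸ j) * trinom X Y j k
  summand j j≤n -[1+ t ] _ = trans (*-zero-* (binom n (+ j)) (W j)) (sym (ZP.*-zeroʳ (binom n (+ j) * Z ^ (n ℕ.∸ j))))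
  summand j j≤n (+ t) M-j≡t with t ℕ.≤? j
  ... | yes t≤j = trans (cong (binom n (+ j) * binom j (+ t) *_) (W≡ j t j≤n t≤j M-j≡t))
                        (regroup (binom n (+ j)) (binom j (+ t)) (Z ^ (n ℕ.∸ j)) (X ^ (j ℕ.∸ t)) (Y ^ t))
  ... | no t≰j  = trans (cong (λ c → binom n (+ j) * c * W j) vanishes)
                   (trans (*-zero-* (binom n (+ j)) (W j))
                          (sym (trans (cong (λ c → binom n (+ j) * Z ^ (n ℕ.∸ j) * (c * X ^ (j ℕ.∸ t) * Y ^ t)) vanishes)
                                      (annihilate (binom n (+ j)) (Z ^ (n ℕ.∸ j)) (X ^ (j ℕ.∸ t)) (Y ^ t)))))
    where
    vanishes : binom j (+ t) ≡ + 0
    vanishes = binom-vanish j t (NP.≰⇒> t≰j)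
    annihilate : ∀ a P Q R → a * P * (+ 0 * Q * R) ≡ + 0
    annihilate = solve-∀

exponent-left : ∀ j t → t ≤ j → ∀ m → + m - + j ≡ + t → + 2 * + j - + m ≡ + (j ℕ.∸ t)
exponent-left j t t≤j m m-j≡t = trans (rearrange (+ j) (+ m)) (trans (cong (λ u → + j - u) m-j≡t) (+-sub j t t≤j))
  where
  rearrange : ∀ j m → + 2 * j - m ≡ j - (m - j)
  rearrange = solve-∀

-- Σ_j C(n,j) C(j,m-j) 2^(2j-m), the left side of the first two identities: [x^m] (1 + x)^(2n).
S₁ : ℕ → ℕ → ℤ
S₁ n m = sumTo n (λ j → binom n (+ j) * binom j (+ m - + j) * powℤ (+ 2) (+ 2 * + j - + m))

S₁-as-pairSum : ∀ n m → S₁ n m ≡ pairSum n (+ m) (λ _ _ → + 1)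
S₁-as-pairSum n m = begin
  S₁ n m
    ≡⟨ binomSum-as-coeffQuad (+ 1) (+ 2) (+ 1) n (+ m) _ (λ j t _ t≤j m-j≡t →
         trans (cong (powℤ (+ 2)) (exponent-left j t t≤j m m-j≡t))
               (sym (trans (cong₂ (λ u v → u * ((+ 2) ^ (j ℕ.∸ t) * v)) (ZP.^-zeroˡ (n ℕ.∸ j)) (ZP.^-zeroˡ t))
                           (units ((+ 2) ^ (j ℕ.∸ t)))))) ⟩
  coeffQuad (+ 1) (+ 2) (+ 1) n (+ m)
    ≡⟨ coeffQuad-factor (+ 1) (+ 1) (+ 1) (+ 1) n (+ m) ⟩
  pairSum n (+ m) (productWeight (+ 1) (+ 1) (+ 1) (+ 1) n)
    ≡⟨ pairSum-cong n (+ m) {productWeight (+ 1) (+ 1) (+ 1) (+ 1) n} {λ _ _ → + 1} (λ i k _ _ _ → all-ones i (n ℕ.∸ i) k (n ℕ.∸ k)) ⟩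
  pairSum n (+ m) (λ _ _ → + 1) ∎
  where
  units : ∀ x → + 1 * (x * + 1) ≡ x
  units = solve-∀
  all-ones : ∀ a b c d → (+ 1) ^ a * (+ 1) ^ b * ((+ 1) ^ c * (+ 1) ^ d) ≡ + 1
  all-ones a b c d rewrite ZP.^-zeroˡ a | ZP.^-zeroˡ b | ZP.^-zeroˡ c | ZP.^-zeroˡ d = refl

S₃ : ℕ → ℕ → ℤ
S₃ n m = sumTo n (λ j → binom n (+ j) * binom j (+ m - + j) * powℤ (+ 2) (+ n - + j) * powℤ (+ 3) (+ 2 * + j - + m))

S₃-as-coeffQuad : ∀ n m → S₃ n m ≡ coeffQuad (+ 2) (+ 3) (+ 1) n (+ m)
S₃-as-coeffQuad n m = trans
  (sumTo-cong n (λ j _ → ZP.*-assoc (binom n (+ j) * binom j (+ m - + j)) (powℤ (+ 2) (+ n - + j)) (powℤ (+ 3) (+ 2 * + j - + m))))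
  (binomSum-as-coeffQuad (+ 2) (+ 3) (+ 1) n (+ m) _ (λ j t j≤n t≤j m-j≡t →
    trans (cong₂ (λ u v → powℤ (+ 2) u * powℤ (+ 3) v) (+-sub n j j≤n) (exponent-left j t t≤j m m-j≡t))
          (cong ((+ 2) ^ (n ℕ.∸ j) *_) (trans (sym (ZP.*-identityʳ ((+ 3) ^ (j ℕ.∸ t))))
                                              (cong ((+ 3) ^ (j ℕ.∸ t) *_) (sym (ZP.^-zeroˡ t)))))))

S₄ : ℕ → ℕ → ℤ
S₄ n m = sumTo n (λ j → binom n (+ j) * binom j (+ m - + j) * signPow (+ m + + j))

sign-double : ∀ t j → (- + 1) ^ (t ℕ.+ j ℕ.+ j) ≡ (- + 1) ^ t
sign-double t zero    = cong ((- + 1) ^_) (trans (NP.+-identityʳ (t ℕ.+ 0)) (NP.+-identityʳ t))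
sign-double t (suc j) = trans (cong ((- + 1) ^_) two-more) (trans (square (((- + 1) ^ (t ℕ.+ j ℕ.+ j)))) (sign-double t j))
  where
  two-more : t ℕ.+ suc j ℕ.+ suc j ≡ suc (suc (t ℕ.+ j ℕ.+ j))
  two-more = trans (cong (ℕ._+ suc j) (NP.+-suc t j)) (cong suc (NP.+-suc (t ℕ.+ j) j))
  square : ∀ x → - + 1 * (- + 1 * x) ≡ x
  square = solve-∀

S₄-as-coeffQuad : ∀ n m → S₄ n m ≡ coeffQuad (+ 1) (+ 1) (- + 1) n (+ m)
S₄-as-coeffQuad n m = binomSum-as-coeffQuad (+ 1) (+ 1) (- + 1) n (+ m) _ (λ j t _ _ m-j≡t → begin
  (- + 1) ^ (m ℕ.+ j)
    ≡⟨ cong (λ u → (- + 1) ^ (u ℕ.+ j)) (ZP.+-injective (m≡t+j m-j≡t)) ⟩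
  (- + 1) ^ (t ℕ.+ j ℕ.+ j)
    ≡⟨ sign-double t j ⟩
  (- + 1) ^ t
    ≡⟨ units ((- + 1) ^ t) ⟩
  + 1 * (+ 1 * (- + 1) ^ t)
    ≡⟨ cong₂ (λ u v → u * (v * (- + 1) ^ t)) (ZP.^-zeroˡ (n ℕ.∸ j)) (ZP.^-zeroˡ (j ℕ.∸ t)) ⟨
  (+ 1) ^ (n ℕ.∸ j) * ((+ 1) ^ (j ℕ.∸ t) * (- + 1) ^ t) ∎)
  where
  units : ∀ s → s ≡ + 1 * (+ 1 * s)
  units = solve-∀
  add-back : ∀ m j → m ≡ (m - j) + j
  add-back = solve-∀
  m≡t+j : ∀ {j t} → + m - + j ≡ + t → + m ≡ + t + + j
  m≡t+j {j} m-j≡t = trans (add-back (+ m) (+ j)) (cong (_+ + j) m-j≡t)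

identity₁ : ∀ n m → S₁ n m ≡ sumToEven (2 ℕ.* n) (m ℕ.+ n) (λ r → Aterm n m r)
identity₁ n m = begin
  S₁ n m
    ≡⟨ S₁-as-pairSum n m ⟩
  pairSum n (+ m) (λ _ _ → + 1)
    ≡⟨ pairSum-cong n (+ m) {λ _ _ → + 1} {λ i j → ext (λ _ → + 1) (+ i + j)} (λ _ _ _ _ _ → refl) ⟩
  pairSum n (+ m) (λ i j → ext (λ _ → + 1) (+ i + j))
    ≡⟨ evenSum-as-pairSum n m (λ _ → + 1) ⟨
  sumToEven (2 ℕ.* n) (m ℕ.+ n) (λ r → Aterm n m r * + 1)
    ≡⟨ sumToEven-cong (2 ℕ.* n) (m ℕ.+ n) (λ r → ZP.*-identityʳ (Aterm n m r)) ⟩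
  sumToEven (2 ℕ.* n) (m ℕ.+ n) (λ r → Aterm n m r) ∎

-- r + 1 = (n + 1) + (i + j - n): the weight r + 1 is n + 1 plus an excess.
identity₂ : ∀ n m → (+ n + + 1) * S₁ n m ≡ sumToEven (2 ℕ.* n) (m ℕ.+ n) (λ r → Aterm n m r * (+ r + + 1))
identity₂ n m = sym (begin
  sumToEven (2 ℕ.* n) (m ℕ.+ n) (λ r → Aterm n m r * (+ r + + 1))
    ≡⟨ evenSum-as-pairSum n m (λ r → + r + + 1) ⟩
  pairSum n (+ m) (λ i j → ext (λ r → + r + + 1) (+ i + j))
    ≡⟨ pairSum-cong n (+ m) {λ i j → ext (λ r → + r + + 1) (+ i + j)} {λ i j → (+ n + + 1) * + 1 + excess n i j}
                    (λ i k _ _ _ → split (+ i) (+ k) (+ n)) ⟩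
  pairSum n (+ m) (λ i j → (+ n + + 1) * + 1 + excess n i j)
    ≡⟨ pairSum-+ n (+ m) (λ _ _ → (+ n + + 1) * + 1) (excess n) ⟩
  pairSum n (+ m) (λ _ _ → (+ n + + 1) * + 1) + pairSum n (+ m) (excess n)
    ≡⟨ cong₂ _+_ (pairSum-scale n (+ m) (+ n + + 1) (λ _ _ → + 1)) (pairSum-excess n (+ m)) ⟩
  (+ n + + 1) * pairSum n (+ m) (λ _ _ → + 1) + + 0
    ≡⟨ ZP.+-identityʳ _ ⟩
  (+ n + + 1) * pairSum n (+ m) (λ _ _ → + 1)
    ≡⟨ cong ((+ n + + 1) *_) (S₁-as-pairSum n m) ⟨
  (+ n + + 1) * S₁ n m ∎)
  where
  split : ∀ x y n → x + y + + 1 ≡ (n + + 1) * + 1 + (x + y - n)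
  split = solve-∀

mersenneWeight : ℕ → ℕ → ℕ → ℤ
mersenneWeight n m r = powℤ (+ 2) (half (+ 3 * + n - + r - + m)) * ((+ 2) ^ suc r - + 1)

-- At r = i + j it equals 2^(n+1) 2^i - 2^(n-j), where 2^i and 2^(n-j) are the product weights
-- of (2 + x)^n (1 + x)^n and of (1 + x)^n (2 + x)^n, both factorisations of (2 + 3x + x²)^n.
mersenneWeight-split : ∀ n m i k → i ≤ n → k ≤ n → partner n (+ m) i ≡ + k →
  mersenneWeight n m (i ℕ.+ k) ≡ (+ 2) ^ suc n * productWeight (+ 2) (+ 1) (+ 1) (+ 1) n i (+ k)
                                 + - + 1 * productWeight (+ 1) (+ 1) (+ 1) (+ 2) n i (+ k)
mersenneWeight-split n m i k i≤n k≤n p≡k = begin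
  powℤ (+ 2) (half (+ 3 * + n - + (i ℕ.+ k) - + m)) * (R - + 1)
    ≡⟨ cong (λ e → powℤ (+ 2) e * (R - + 1)) half≡ ⟩
  P * (R - + 1)
    ≡⟨ expand P R S Q PR≡SQ ⟩
  S * Q + - + 1 * P
    ≡⟨ cong₂ (λ u v → S * u + - + 1 * v) W₁≡Q W₂≡P ⟨
  S * productWeight (+ 2) (+ 1) (+ 1) (+ 1) n i (+ k) + - + 1 * productWeight (+ 1) (+ 1) (+ 1) (+ 2) n i (+ k) ∎
  where
  S = (+ 2) ^ suc n
  P = (+ 2) ^ (n ℕ.∸ k)
  R = (+ 2) ^ suc (i ℕ.+ k)
  Q = (+ 2) ^ i
  exponent : ∀ i m n k → i + (m - n) ≡ k → + 3 * n - (i + k) - m ≡ (n - k) * + 2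
  exponent i m n k i+m-n≡k = trans (rearrange i m n k) (trans (cong (λ u → (n - k) * + 2 - (u - k)) i+m-n≡k) (cancel n k))
    where
    rearrange : ∀ i m n k → + 3 * n - (i + k) - m ≡ (n - k) * + 2 - (i + (m - n) - k)
    rearrange = solve-∀
    cancel : ∀ n k → (n - k) * + 2 - (k - k) ≡ (n - k) * + 2
    cancel = solve-∀
  half≡ : half (+ 3 * + n - + (i ℕ.+ k) - + m) ≡ + (n ℕ.∸ k)
  half≡ = trans (cong half (exponent (+ i) (+ m) (+ n) (+ k) p≡k)) (trans (half-double (+ n - + k)) (+-sub n k k≤n))
  expand : ∀ P R S Q → P * R ≡ S * Q → P * (R - + 1) ≡ S * Q + - + 1 * P
  expand P R S Q PR≡SQ = trans (distrib P R) (cong (_+ - + 1 * P) PR≡SQ)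
    where
    distrib : ∀ P R → P * (R - + 1) ≡ P * R + - + 1 * P
    distrib = solve-∀
  sum-exponents : (n ℕ.∸ k) ℕ.+ suc (i ℕ.+ k) ≡ suc n ℕ.+ i
  sum-exponents = ZP.+-injective (trans (cong (_+ + suc (i ℕ.+ k)) (sym (+-sub n k k≤n))) (telescope (+ n) (+ k) (+ i)))
    where
    telescope : ∀ n k i → (n - k) + (+ 1 + (i + k)) ≡ + 1 + n + i
    telescope = solve-∀
  PR≡SQ : P * R ≡ S * Q
  PR≡SQ = trans (sym (ZP.^-distribˡ-+-* (+ 2) (n ℕ.∸ k) (suc (i ℕ.+ k))))
                (trans (cong ((+ 2) ^_) sum-exponents) (ZP.^-distribˡ-+-* (+ 2) (suc n) i))
  ones-right : ∀ x → x * + 1 * (+ 1 * + 1) ≡ x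
  ones-right = solve-∀
  ones-left : ∀ x → + 1 * + 1 * (+ 1 * x) ≡ x
  ones-left = solve-∀
  W₁≡Q : productWeight (+ 2) (+ 1) (+ 1) (+ 1) n i (+ k) ≡ Q
  W₁≡Q = trans (cong₂ (λ u v → Q * u * v) (ZP.^-zeroˡ (n ℕ.∸ i)) (cong₂ _*_ (ZP.^-zeroˡ k) (ZP.^-zeroˡ (n ℕ.∸ k))))
               (ones-right Q)
  W₂≡P : productWeight (+ 1) (+ 1) (+ 1) (+ 2) n i (+ k) ≡ P
  W₂≡P = trans (cong₂ (λ u v → u * (v * P)) (cong₂ _*_ (ZP.^-zeroˡ i) (ZP.^-zeroˡ (n ℕ.∸ i))) (ZP.^-zeroˡ k))
               (ones-left P)

identity₃ : ∀ n m → ((+ 2) ^ suc n - + 1) * S₃ n m ≡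
  sumToEven (2 ℕ.* n) (m ℕ.+ n) (λ r → Aterm n m r * powℤ (+ 2) (half (+ 3 * + n - + r - + m)) * ((+ 2) ^ suc r - + 1))
identity₃ n m = sym (begin
  sumToEven (2 ℕ.* n) (m ℕ.+ n) (λ r → Aterm n m r * powℤ (+ 2) (half (+ 3 * + n - + r - + m)) * ((+ 2) ^ suc r - + 1))
    ≡⟨ sumToEven-cong (2 ℕ.* n) (m ℕ.+ n) (λ r → ZP.*-assoc (Aterm n m r) _ _) ⟩
  sumToEven (2 ℕ.* n) (m ℕ.+ n) (λ r → Aterm n m r * mersenneWeight n m r)
    ≡⟨ evenSum-as-pairSum n m (mersenneWeight n m) ⟩
  pairSum n (+ m) (λ i j → ext (mersenneWeight n m) (+ i + j))
    ≡⟨ pairSum-cong n (+ m) {λ i j → ext (mersenneWeight n m) (+ i + j)} {λ i j → S * W₁ i j + - + 1 * W₂ i j}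
                    (mersenneWeight-split n m) ⟩
  pairSum n (+ m) (λ i j → S * W₁ i j + - + 1 * W₂ i j)
    ≡⟨ pairSum-+ n (+ m) (λ i j → S * W₁ i j) (λ i j → - + 1 * W₂ i j) ⟩
  pairSum n (+ m) (λ i j → S * W₁ i j) + pairSum n (+ m) (λ i j → - + 1 * W₂ i j)
    ≡⟨ cong₂ _+_ (pairSum-scale n (+ m) S W₁) (pairSum-scale n (+ m) (- + 1) W₂) ⟩
  S * pairSum n (+ m) W₁ + - + 1 * pairSum n (+ m) W₂
    ≡⟨ cong₂ (λ u v → S * u + - + 1 * v) (coeffQuad-factor (+ 2) (+ 1) (+ 1) (+ 1) n (+ m))
                                         (coeffQuad-factor (+ 1) (+ 1) (+ 1) (+ 2) n (+ m)) ⟨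
  S * L + - + 1 * L
    ≡⟨ factor-out S L ⟩
  (S - + 1) * L
    ≡⟨ cong ((S - + 1) *_) (S₃-as-coeffQuad n m) ⟨
  (S - + 1) * S₃ n m ∎)
  where
  S = (+ 2) ^ suc n
  L = coeffQuad (+ 2) (+ 3) (+ 1) n (+ m)
  W₁ = productWeight (+ 2) (+ 1) (+ 1) (+ 1) n
  W₂ = productWeight (+ 1) (+ 1) (+ 1) (+ 2) n
  factor-out : ∀ S L → S * L + - + 1 * L ≡ (S - + 1) * L
  factor-out = solve-∀

signedFib : ℕ → ℕ → ℕ → ℤ
signedFib n m r = signPow (half (- + n + + r - + m)) * + fib (r ℕ.+ 2)

-- At r = i + j the sign (-1)^((r-m-n)/2) is (-1)^(n-i), so the weight is fibWeight n 2.
signedFib-as-fibWeight : ∀ n m i k → i ≤ n → k ≤ n → partner n (+ m) i ≡ + k →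
  signedFib n m (i ℕ.+ k) ≡ fibWeight n 2 i (+ k)
signedFib-as-fibWeight n m i k i≤n _ p≡k =
  cong₂ _*_ (cong ((- + 1) ^_) (trans (cong ℤ.∣_∣ half≡) distance)) (cong (λ u → + fib u) (NP.+-comm (i ℕ.+ k) 2))
  where
  exponent : ∀ i m n k → i + (m - n) ≡ k → - n + (i + k) - m ≡ (i - n) * + 2
  exponent i m n k i+m-n≡k = trans (rearrange i m n k) (trans (cong (λ u → (i - n) * + 2 + (k - u)) i+m-n≡k) (cancel i n k))
    where
    rearrange : ∀ i m n k → - n + (i + k) - m ≡ (i - n) * + 2 + (k - (i + (m - n)))
    rearrange = solve-∀
    cancel : ∀ i n k → (i - n) * + 2 + (k - k) ≡ (i - n) * + 2
    cancel = solve-∀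
  half≡ : half (- + n + + (i ℕ.+ k) - + m) ≡ + i - + n
  half≡ = trans (cong half (exponent (+ i) (+ m) (+ n) (+ k) p≡k)) (half-double (+ i - + n))
  distance : ℤ.∣ + i - + n ∣ ≡ n ℕ.∸ i
  distance = trans (cong ℤ.∣_∣ (ZP.[+m]-[+n]≡m⊖n i n)) (ZP.∣⊖∣-≤ i≤n)

identity₄ : ∀ n m → + fib (n ℕ.+ 2) * S₄ n m ≡
  sumToEven (2 ℕ.* n) (m ℕ.+ n) (λ r → Aterm n m r * signPow (half (- + n + + r - + m)) * + fib (r ℕ.+ 2))
identity₄ n m = sym (begin
  sumToEven (2 ℕ.* n) (m ℕ.+ n) (λ r → Aterm n m r * signPow (half (- + n + + r - + m)) * + fib (r ℕ.+ 2))
    ≡⟨ sumToEven-cong (2 ℕ.* n) (m ℕ.+ n) (λ r → ZP.*-assoc (Aterm n m r) _ _) ⟩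
  sumToEven (2 ℕ.* n) (m ℕ.+ n) (λ r → Aterm n m r * signedFib n m r)
    ≡⟨ evenSum-as-pairSum n m (signedFib n m) ⟩
  pairSum n (+ m) (λ i j → ext (signedFib n m) (+ i + j))
    ≡⟨ pairSum-cong n (+ m) {λ i j → ext (signedFib n m) (+ i + j)} {fibWeight n 2} (signedFib-as-fibWeight n m) ⟩
  pairSum n (+ m) (fibWeight n 2)
    ≡⟨ pairSum-fib n (+ m) 2 ⟩
  + fib (2 ℕ.+ n) * coeffQuad (+ 1) (+ 1) (- + 1) n (+ m)
    ≡⟨ cong₂ (λ u v → + fib u * v) (NP.+-comm n 2) (S₄-as-coeffQuad n m) ⟨
  + fib (n ℕ.+ 2) * S₄ n m ∎)

corollary4 : (n : ℕ) → NonZero n → (m : ℕ) → m ℕ.≤ 2 ℕ.* n →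
  let N = + n
      M = + m
      A : ℕ → ℤ
      A r = binom n (half (+ r - M + N)) * binom n (half (+ r + M - N))
  in (sumTo n (λ j → binom n (+ j) * binom j (M - + j) * powℤ (+ 2) (+ 2 * + j - M))
        ≡ sumToEven (2 ℕ.* n) (m ℕ.+ n) (λ r → A r))
   × ((N + + 1) * sumTo n (λ j → binom n (+ j) * binom j (M - + j) * powℤ (+ 2) (+ 2 * + j - M))
        ≡ sumToEven (2 ℕ.* n) (m ℕ.+ n) (λ r → A r * (+ r + + 1)))
   × (((+ 2) ^ (ℕ.suc n) - + 1)
        * sumTo n (λ j → binom n (+ j) * binom j (M - + j)
                           * powℤ (+ 2) (N - + j) * powℤ (+ 3) (+ 2 * + j - M))
        ≡ sumToEven (2 ℕ.* n) (m ℕ.+ n)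
            (λ r → A r * powℤ (+ 2) (half (+ 3 * N - + r - M)) * ((+ 2) ^ (ℕ.suc r) - + 1)))
   × (+ (fib (n ℕ.+ 2)) * sumTo n (λ j → binom n (+ j) * binom j (M - + j) * signPow (M + + j))
        ≡ sumToEven (2 ℕ.* n) (m ℕ.+ n)
            (λ r → A r * signPow (half (- N + + r - M)) * + (fib (r ℕ.+ 2))))
corollary4 n _ m _ = identity₁ n m , identity₂ n m , identity₃ n m , identity₄ n m
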